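{- For every integer $n\ge 3$, the digraph $\overrightarrow{K_n}$ is a vertex-antimagic total digraph.
   Context: $\overrightarrow{K_n}$ is the directed graph with vertex set $V=\{v_1,\dots,v_n\}$ and arc set $E$ consisting of, for every pair $1\le i<j\le n$, exactly one arc directed from $v_i$ to $v_j$; $l=|E|=\binom n2$. A total labeling of a directed graph is a bijection $f:V\cup E\to\{1,2,\dots,n+l\}$. The vertex-weight of a vertex $v$ under $f$ is $w_f(v)=f(v)+S^-_v+S^+_v$, where $S^-_v$ is the sum of $f$ over arcs entering $v$ and $S^+_v$ the sum of $f$ over arcs leaving $v$. A total labeling is vertex-antimagic total if all vertex-weights are pairwise distinct, and a digraph is a vertex-antimagic total digraph if it admits such a labeling. -}

module Defs where

open import Data.Nat using (ℕ; suc; _+_)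
open import Data.Nat.Combinatorics using (_C_)
open import Data.Fin using (Fin; toℕ; _<_)
open import Data.Fin.Properties using (_<?_)
open import Data.List using (List; map; allFin)
open import Data.Nat.ListAction using (sum)
open import Data.Product using (Σ; _×_; _,_; ∃-syntax)
open import Relation.Nullary using (yes; no)
open import Relation.Binary.PropositionalEquality using (_≡_)
open import Function.Bundles using (_⤖_; Bijection)

-- The elements of V ∪ E of the digraph K⃗ₙ:
-- vertices v_i (i : Fin n) and, for each pair i < j, the arc from v_i to v_j.
data Elem (n : ℕ) : Set where
  vertex : Fin n → Elem n
  arc    : (i j : Fin n) → i < j → Elem n

arcCount : ℕ → ℕ
arcCount n = n C 2

-- A total labeling: a bijection V ∪ E → {1, …, n + l}.
-- We represent {1,…,n+l} by Fin (n + l), the label of x being suc (toℕ (g x)).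
TotalLabeling : ℕ → Set
TotalLabeling n = Elem n ⤖ Fin (n + arcCount n)

label : ∀ {n} → TotalLabeling n → Elem n → ℕ
label f x = suc (toℕ (Bijection.to f x))

inSum : ∀ {n} → TotalLabeling n → Fin n → ℕ
inSum {n} f v = sum (map g (allFin n))
  where
  g : Fin n → ℕ
  g i with i <? v
  ... | yes p = label f (arc i v p)
  ... | no _  = 0

outSum : ∀ {n} → TotalLabeling n → Fin n → ℕ
outSum {n} f v = sum (map g (allFin n))
  where
  g : Fin n → ℕ
  g j with v <? j
  ... | yes p = label f (arc v j p)
  ... | no _  = 0

weight : ∀ {n} → TotalLabeling n → Fin n → ℕ
weight f v = label f (vertex v) + inSum f v + outSum f v

IsVertexAntimagicTotal : ∀ {n} → TotalLabeling n → Set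
IsVertexAntimagicTotal {n} f = ∀ (u v : Fin n) → weight f u ≡ weight f v → u ≡ v

VertexAntimagicTotalKn : ℕ → Set
VertexAntimagicTotalKn n = ∃[ f ] IsVertexAntimagicTotal {n} f

-- Order V ∪ E lexicographically by (larger endpoint, smaller endpoint), a vertex v
-- being the pair (v , v), and label the elements 1, 2, …, n + l in this order:
-- the element joining v and k gets 1 + T (v ⊔ k) + v ⊓ k, T the triangular numbers.
-- The weight of v is the sum over k of the label of the element joining v and k;
-- each term is monotone in v, strictly at k = v, so the weights strictly increase
-- with v.
module Submission where

open import Defs
open import Data.Nat using (ℕ; _≤_)
open import Data.Nat.Base using (zero; suc; _+_; _∸_; _⊔_; _⊓_; _<_; z≤n; s≤s; s≤s⁻¹)
open import Data.Nat.Properties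
open import Data.Nat.Combinatorics using (_C_; nC1≡n; nCk+nC[k+1]≡[n+1]C[k+1])
import Data.Nat.ListAction as List
open import Data.Fin.Base as Fin using (Fin; toℕ; fromℕ<; punchIn)
open import Data.Fin.Properties as Fin using (toℕ-injective; toℕ-fromℕ<; toℕ<n; punchInᵢ≢i)
open import Data.List.Base using (map; allFin; tabulate)
open import Data.List.Properties using (map-tabulate)
open import Data.Product.Base using (_×_; _,_; ∃-syntax)
open import Relation.Nullary using (yes; no; contradiction)
open import Relation.Binary.Definitions using (tri<; tri≈; tri>)
open import Relation.Binary.PropositionalEquality
open import Function.Base using (_∘′_)
open import Function.Bundles using (mk⤖)
open import Algebra.Properties.CommutativeMonoid.Sum +-0-commutativeMonoid
  using (sum-syntax; sum-remove; ∑-distrib-+; sum-cong-≗)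

triangle : ℕ → ℕ
triangle zero    = 0
triangle (suc m) = triangle m + suc m

triangle-mono-≤ : ∀ {a b} → a ≤ b → triangle a ≤ triangle b
triangle-mono-≤ {zero}  _         = z≤n
triangle-mono-≤ {suc a} (s≤s a≤b) = +-mono-≤ (triangle-mono-≤ a≤b) (s≤s a≤b)

n+nC2≡triangle : ∀ n → n + arcCount n ≡ triangle n
n+nC2≡triangle zero    = refl
n+nC2≡triangle (suc n) = begin
  suc n + suc n C 2        ≡⟨ cong (suc n +_) (nCk+nC[k+1]≡[n+1]C[k+1] n 1) ⟨
  suc n + (n C 1 + n C 2)  ≡⟨ cong (λ m → suc n + (m + n C 2)) (nC1≡n n) ⟩
  suc n + (n + n C 2)      ≡⟨ cong (suc n +_) (n+nC2≡triangle n) ⟩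
  suc n + triangle n       ≡⟨ +-comm (suc n) (triangle n) ⟩
  triangle (suc n)         ∎
  where open ≡-Reasoning

pairing : ℕ → ℕ → ℕ
pairing j i = triangle j + i

pairing-<-triangle : ∀ {i j m} → i ≤ j → j < m → pairing j i < triangle m
pairing-<-triangle {j = j} i≤j j<m =
  <-≤-trans (+-monoʳ-< (triangle j) (s≤s i≤j)) (triangle-mono-≤ j<m)

pairing-monoˡ-< : ∀ {i j i′ j′} → i ≤ j → j < j′ → pairing j i < pairing j′ i′
pairing-monoˡ-< {i′ = i′} i≤j j<j′ =
  <-≤-trans (pairing-<-triangle i≤j j<j′) (m≤m+n _ i′)

pairing-injective : ∀ {i j i′ j′} → i ≤ j → i′ ≤ j′ →
                    pairing j i ≡ pairing j′ i′ → j ≡ j′ × i ≡ i′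
pairing-injective {i} {j} {i′} {j′} i≤j i′≤j′ eq with <-cmp j j′
... | tri< j<j′ _ _ = contradiction eq (<⇒≢ (pairing-monoˡ-< i≤j j<j′))
... | tri> _ _ j′<j = contradiction eq (≢-sym (<⇒≢ (pairing-monoˡ-< i′≤j′ j′<j)))
... | tri≈ _ refl _ = refl , +-cancelˡ-≡ (triangle j) i i′ eq

pairing-surjective : ∀ m {p} → p < triangle m →
                     ∃[ j ] ∃[ i ] j < m × i ≤ j × pairing j i ≡ p
pairing-surjective (suc m) {p} p<Tm+1 with p <? triangle m
... | yes p<Tm with pairing-surjective m p<Tm
...   | j , i , j<m , i≤j , eq = j , i , m≤n⇒m≤1+n j<m , i≤j , eq
pairing-surjective (suc m) {p} p<Tm+1 | no p≮Tm =
  m , p ∸ triangle m , ≤-refl , s≤s⁻¹ (m<n+o⇒m∸n<o p (triangle m) p<Tm+1) , m+[n∸m]≡n (≮⇒≥ p≮Tm)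

unorderedPairing : ℕ → ℕ → ℕ
unorderedPairing a b = pairing (a ⊔ b) (a ⊓ b)

unorderedPairing-monoˡ-≤ : ∀ {a b} c → a ≤ b → unorderedPairing a c ≤ unorderedPairing b c
unorderedPairing-monoˡ-≤ c a≤b =
  +-mono-≤ (triangle-mono-≤ (⊔-monoˡ-≤ c a≤b)) (⊓-monoˡ-≤ c a≤b)

unorderedPairing-diag-< : ∀ {a b} → a < b → unorderedPairing a a < unorderedPairing b a
unorderedPairing-diag-< {a} {b} a<b
  rewrite ⊔-idem a | ⊓-idem a | m≥n⇒m⊔n≡m (<⇒≤ a<b) | m≥n⇒m⊓n≡n (<⇒≤ a<b) =
  pairing-monoˡ-< ≤-refl a<b

index : ∀ {n} → Elem n → ℕ
index (vertex v)  = pairing (toℕ v) (toℕ v)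
index (arc i j _) = pairing (toℕ j) (toℕ i)

index<size : ∀ {n} (x : Elem n) → index x < n + arcCount n
index<size {n} x rewrite n+nC2≡triangle n = bound x
  where
  bound : (x : Elem n) → index x < triangle n
  bound (vertex v)  = pairing-<-triangle ≤-refl (toℕ<n v)
  bound (arc i j p) = pairing-<-triangle (<⇒≤ p) (toℕ<n j)

arc-cong : ∀ {n} {i j i′ j′ : Fin n} {p : i Fin.< j} {p′ : i′ Fin.< j′} →
           i ≡ i′ → j ≡ j′ → arc i j p ≡ arc i′ j′ p′
arc-cong {p = p} {p′} refl refl = cong (arc _ _) (<-irrelevant p p′)

index-injective : ∀ {n} (x y : Elem n) → index x ≡ index y → x ≡ y
index-injective (vertex v) (vertex w) eq
  with v≡w , _ ← pairing-injective (≤-refl {toℕ v}) (≤-refl {toℕ w}) eq =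
  cong vertex (toℕ-injective v≡w)
index-injective (vertex v) (arc i j p) eq
  with v≡j , v≡i ← pairing-injective (≤-refl {toℕ v}) (<⇒≤ p) eq =
  contradiction (trans (sym v≡i) v≡j) (<⇒≢ p)
index-injective (arc i j p) (vertex v) eq
  with j≡v , i≡v ← pairing-injective (<⇒≤ p) (≤-refl {toℕ v}) eq =
  contradiction (trans i≡v (sym j≡v)) (<⇒≢ p)
index-injective (arc i j p) (arc i′ j′ p′) eq
  with j≡j′ , i≡i′ ← pairing-injective (<⇒≤ p) (<⇒≤ p′) eq =
  arc-cong (toℕ-injective i≡i′) (toℕ-injective j≡j′)

index-surjective : ∀ {n p} → p < n + arcCount n → ∃[ x ] index {n} x ≡ p
index-surjective {n} p<size rewrite n+nC2≡triangle n
  with j , i , j<n , i≤j , refl ← pairing-surjective n p<size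
  with i <? j
... | yes i<j = arc (fromℕ< i<n) (fromℕ< j<n) i<j′ ,
                cong₂ pairing (toℕ-fromℕ< j<n) (toℕ-fromℕ< i<n)
  where
  i<n : i < n
  i<n = ≤-<-trans i≤j j<n
  i<j′ : fromℕ< i<n Fin.< fromℕ< j<n
  i<j′ = subst₂ _<_ (sym (toℕ-fromℕ< i<n)) (sym (toℕ-fromℕ< j<n)) i<j
... | no i≮j with refl ← ≤-antisym i≤j (≮⇒≥ i≮j) =
  vertex (fromℕ< j<n) , cong (λ k → pairing k k) (toℕ-fromℕ< j<n)

labeling : ∀ n → TotalLabeling n
labeling n = mk⤖ {to = encode} (injective , surjective)
  where
  encode : Elem n → Fin (n + arcCount n)
  encode x = fromℕ< (index<size x)
  injective : ∀ {x y} → encode x ≡ encode y → x ≡ y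
  injective {x} {y} eq = index-injective x y (begin
    index x           ≡⟨ toℕ-fromℕ< (index<size x) ⟨
    toℕ (encode x)    ≡⟨ cong toℕ eq ⟩
    toℕ (encode y)    ≡⟨ toℕ-fromℕ< (index<size y) ⟩
    index y           ∎)
    where open ≡-Reasoning
  surjective : ∀ y → ∃[ x ] (∀ {z} → z ≡ x → encode z ≡ y)
  surjective y with x , eq ← index-surjective (toℕ<n y) =
    x , λ { refl → toℕ-injective (trans (toℕ-fromℕ< (index<size x)) eq) }

label-labeling : ∀ {n} (x : Elem n) → label (labeling n) x ≡ suc (index x)
label-labeling x = cong suc (toℕ-fromℕ< (index<size x))

link : ∀ {n} → Fin n → Fin n → Elem n
link v k with Fin.<-cmp k v
... | tri< k<v _ _ = arc k v k<v
... | tri≈ _ _ _   = vertex v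
... | tri> _ _ v<k = arc v k v<k

-- Defs keeps the summands of S⁻ and S⁺ local; unification against their
-- unfolding recovers them.
summands : ∀ {n s} {g : Fin n → ℕ} → s ≡ List.sum (map g (allFin n)) → Fin n → ℕ
summands {g = g} _ = g

inSummand outSummand : ∀ {n} → TotalLabeling n → Fin n → Fin n → ℕ
inSummand  f v = summands {s = inSum f v} refl
outSummand f v = summands {s = outSum f v} refl

List-sum≡∑ : ∀ {n} (g : Fin n → ℕ) → List.sum (map g (allFin n)) ≡ ∑[ k < n ] g k
List-sum≡∑ g = trans (cong List.sum (map-tabulate (λ k → k) g)) (sum-tabulate g)
  where
  sum-tabulate : ∀ {m} (h : Fin m → ℕ) → List.sum (tabulate h) ≡ ∑[ k < m ] h k
  sum-tabulate {zero}  h = refl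
  sum-tabulate {suc m} h = cong (h Fin.zero +_) (sum-tabulate (λ k → h (Fin.suc k)))

summands-diag : ∀ {n} (f : TotalLabeling n) v → inSummand f v v + outSummand f v v ≡ 0
summands-diag f v with v Fin.<? v | v Fin.<? v
... | no _    | no _    = refl
... | yes v<v | _       = contradiction v<v (Fin.<-irrefl refl)
... | no _    | yes v<v = contradiction v<v (Fin.<-irrefl refl)

summands-offdiag : ∀ {n} (f : TotalLabeling n) {v k} → k ≢ v →
                   inSummand f v k + outSummand f v k ≡ label f (link v k)
summands-offdiag f {v} {k} k≢v with Fin.<-cmp k v | k Fin.<? v | v Fin.<? k
... | tri< _ _ _   | yes _   | no _    = trans (+-identityʳ _) (cong (label f ∘′ arc k v) (<-irrelevant _ _))
... | tri< k<v _ _ | no k≮v  | _       = contradiction k<v k≮v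
... | tri< k<v _ _ | _       | yes v<k = contradiction v<k (<⇒≯ k<v)
... | tri≈ _ k≡v _ | _       | _       = contradiction k≡v k≢v
... | tri> _ _ _   | no _    | yes v<k = cong (label f ∘′ arc v k) (<-irrelevant _ _)
... | tri> _ _ v<k | yes k<v | _       = contradiction v<k (<⇒≯ k<v)
... | tri> _ _ v<k | _       | no v≮k  = contradiction v<k v≮k

link-diag : ∀ {n} (v : Fin n) → link v v ≡ vertex v
link-diag v with Fin.<-cmp v v
... | tri< v<v _ _ = contradiction v<v (Fin.<-irrefl refl)
... | tri≈ _ _ _   = refl
... | tri> _ _ v<v = contradiction v<v (Fin.<-irrefl refl)

inSum+outSum≡∑link : ∀ {n} (f : TotalLabeling (suc n)) v →
  inSum f v + outSum f v ≡ ∑[ j < n ] label f (link v (punchIn v j))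
inSum+outSum≡∑link {n} f v = begin
  inSum f v + outSum f v
    ≡⟨ cong₂ _+_ (List-sum≡∑ (inSummand f v)) (List-sum≡∑ (outSummand f v)) ⟩
  ∑[ k < suc n ] inSummand f v k + ∑[ k < suc n ] outSummand f v k
    ≡⟨ ∑-distrib-+ (inSummand f v) (outSummand f v) ⟨
  ∑[ k < suc n ] incident k
    ≡⟨ sum-remove {i = v} incident ⟩
  incident v + ∑[ j < n ] incident (punchIn v j)
    ≡⟨ cong₂ _+_ (summands-diag f v)
                 (sum-cong-≗ (λ j → summands-offdiag f (punchInᵢ≢i v j))) ⟩
  ∑[ j < n ] label f (link v (punchIn v j))
    ∎
  where
  open ≡-Reasoning
  incident : Fin (suc n) → ℕ
  incident k = inSummand f v k + outSummand f v k

weight≡∑link : ∀ {n} (f : TotalLabeling n) v → weight f v ≡ ∑[ k < n ] label f (link v k)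
weight≡∑link {suc n} f v = begin
  label f (vertex v) + inSum f v + outSum f v
    ≡⟨ +-assoc (label f (vertex v)) _ _ ⟩
  label f (vertex v) + (inSum f v + outSum f v)
    ≡⟨ cong₂ _+_ (cong (label f) (sym (link-diag v))) (inSum+outSum≡∑link f v) ⟩
  label f (link v v) + ∑[ j < n ] label f (link v (punchIn v j))
    ≡⟨ sum-remove {i = v} (label f ∘′ link v) ⟨
  ∑[ k < suc n ] label f (link v k)
    ∎
  where open ≡-Reasoning

∑-mono-≤ : ∀ {n} {a b : Fin n → ℕ} → (∀ k → a k ≤ b k) → ∑[ k < n ] a k ≤ ∑[ k < n ] b k
∑-mono-≤ {zero}  a≤b = z≤n
∑-mono-≤ {suc n} a≤b = +-mono-≤ (a≤b Fin.zero) (∑-mono-≤ (λ k → a≤b (Fin.suc k)))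

∑-mono-< : ∀ {n} {a b : Fin n → ℕ} → (∀ k → a k ≤ b k) → ∀ i → a i < b i →
           ∑[ k < n ] a k < ∑[ k < n ] b k
∑-mono-< {suc n} {a} {b} a≤b i aᵢ<bᵢ = begin-strict
  ∑[ k < suc n ] a k                 ≡⟨ sum-remove {i = i} a ⟩
  a i + ∑[ j < n ] a (punchIn i j)   <⟨ +-mono-<-≤ aᵢ<bᵢ (∑-mono-≤ (λ j → a≤b (punchIn i j))) ⟩
  b i + ∑[ j < n ] b (punchIn i j)   ≡⟨ sum-remove {i = i} b ⟨
  ∑[ k < suc n ] b k                 ∎
  where open ≤-Reasoning

index-link : ∀ {n} (v k : Fin n) → index (link v k) ≡ unorderedPairing (toℕ v) (toℕ k)
index-link v k with Fin.<-cmp k v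
... | tri< k<v _ _ = sym (cong₂ pairing (m≥n⇒m⊔n≡m (<⇒≤ k<v)) (m≥n⇒m⊓n≡n (<⇒≤ k<v)))
... | tri≈ _ refl _ = sym (cong₂ pairing (⊔-idem (toℕ v)) (⊓-idem (toℕ v)))
... | tri> _ _ v<k = sym (cong₂ pairing (m≤n⇒m⊔n≡n (<⇒≤ v<k)) (m≤n⇒m⊓n≡m (<⇒≤ v<k)))

weight-labeling : ∀ {n} (v : Fin n) →
                  weight (labeling n) v ≡ ∑[ k < n ] suc (unorderedPairing (toℕ v) (toℕ k))
weight-labeling v = trans (weight≡∑link (labeling _) v)
  (sum-cong-≗ (λ k → trans (label-labeling (link v k)) (cong suc (index-link v k))))

weight-labeling-strictlyIncreasing : ∀ {n} {u v : Fin n} → u Fin.< v →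
                                     weight (labeling n) u < weight (labeling n) v
weight-labeling-strictlyIncreasing {u = u} {v} u<v
  rewrite weight-labeling u | weight-labeling v =
  ∑-mono-< (λ k → s≤s (unorderedPairing-monoˡ-≤ (toℕ k) (<⇒≤ u<v)))
           u (s≤s (unorderedPairing-diag-< u<v))

strictlyIncreasing⇒injective : ∀ {n} (w : Fin n → ℕ) → (∀ {u v} → u Fin.< v → w u < w v) →
                               ∀ u v → w u ≡ w v → u ≡ v
strictlyIncreasing⇒injective w increasing u v wu≡wv with Fin.<-cmp u v
... | tri< u<v _ _ = contradiction wu≡wv (<⇒≢ (increasing u<v))
... | tri≈ _ u≡v _ = u≡v
... | tri> _ _ v<u = contradiction wu≡wv (≢-sym (<⇒≢ (increasing v<u)))

theorem3 : (n : ℕ) → 3 ≤ n → VertexAntimagicTotalKn n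
theorem3 n _ = labeling n ,
  strictlyIncreasing⇒injective (weight (labeling n)) weight-labeling-strictlyIncreasing
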